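{- Let $\mathcal{S}$, $\mathcal{MM}_2$ and $\phi:\mathcal{S}\to\mathcal{MM}_2$ be as described in the context. (a) If $w\in\mathcal{S}$ can be written as a concatenation $w=w_1w_2$ with $w_1,w_2\in\mathcal{S}$, then $\phi(w)=\phi(w_1)\phi(w_2)$ (concatenation). (b) Conversely, if $w\in\mathcal{S}$ and $\phi(w)=m_1m_2$ for some $m_1,m_2\in\mathcal{MM}_2$, then there exist $w_1,w_2\in\mathcal{S}$ with $m_1=\phi(w_1)$, $m_2=\phi(w_2)$ and $w=w_1w_2$.
   Context: A quarter plane walk is a finite walk in $\mathbb{Z}^2$ starting at $(0,0)$, staying in $\{(i,j): i\ge 0, j\ge 0\}$, using steps from a given set; its length is its number of steps. $\mathcal{S}$ is the class of quarter plane walks with steps from $\{(1,0),(1,-1),(0,-1),(-1,0),(-1,1),(0,1)\}$, written $\rightarrow,\searrow,\downarrow,\leftarrow,\nwarrow,\uparrow$ respectively. Concatenation $w_1w_2$ of walks means the sequence of steps of $w_1$ followed by the steps of $w_2$ (so $w_1,w_2\in\mathcal{S}$ means each, as a walk from the origin, stays in the quarter plane). A Motzkin path is a walk from $(0,0)$ using the steps $\nearrow=(1,1)$, $\rightarrow=(1,0)$, $\searrow=(1,-1)$, never going below the $x$-axis and ending on the $x$-axis. $\mathcal{MM}_2$ is the class of Motzkin paths in which each step is coloured red or black and is additionally either marked or unmarked; concatenation of such paths is defined as the sequence of (coloured, marked) steps of the first followed by those of the second. The map $\phi$: given $w\in\mathcal{S}$, start with the empty path $m$ and read the steps of $w$ from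 first to last, modifying $m$ as follows. (1) Step $\uparrow$: append a marked red $\rightarrow$ to $m$. (2) Step $\rightarrow$: append a marked black $\rightarrow$ to $m$. (3) Step $\searrow$: find the rightmost step of $m$ that is either a marked red $\rightarrow$ or a marked black $\searrow$; if it is a marked red $\rightarrow$ replace it by an unmarked red $\nearrow$, if it is a marked black $\searrow$ replace it by an unmarked black $\rightarrow$. Then append a marked red $\searrow$. (4) Step $\nwarrow$: find the rightmost step of $m$ that is either a marked black $\rightarrow$ or a marked red $\searrow$; if it is a marked black $\rightarrow$ replace it by an unmarked black $\nearrow$, if it is a marked red $\searrow$ replace it by an unmarked red $\rightarrow$. Then append a marked black $\searrow$. (5) Step $\leftarrow$: perform the same search and replacement as in (4), then append an unmarked red $\searrow$. (6) Step $\downarrow$: perform the same search and replacement as in (3), then append an unmarked black $\searrow$. The final $m$ is $\phi(w)$. (It is known that this procedure is always well defined and yields an element of $\mathcal{MM}_2$.) -}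

module Defs where

open import Data.Bool using (Bool; true; false)
open import Data.Integer using (ℤ; +_; _+_; -_; _≤_; 0ℤ; 1ℤ; -1ℤ)
open import Data.List using (List; []; _∷_; _++_; reverse; foldl)
open import Data.Product using (_×_; _,_)
open import Data.Unit using (⊤)
open import Relation.Binary.PropositionalEquality using (_≡_)

data Step : Set where
  E SE S W NW N : Step

Walk : Set
Walk = List Step

dx dy : Step → ℤ
dx E = 1ℤ
dx SE = 1ℤ
dx S = 0ℤ
dx W = -1ℤ
dx NW = -1ℤ
dx N = 0ℤ
dy E = 0ℤ
dy SE = -1ℤ
dy S = -1ℤ
dy W = 0ℤ
dy NW = 1ℤ
dy N = 1ℤ

data StaysIn : ℤ → ℤ → Walk → Set where
  done : ∀ {x y} → 0ℤ ≤ x → 0ℤ ≤ y → StaysIn x y []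
  step : ∀ {x y s w} → 0ℤ ≤ x → 0ℤ ≤ y →
         StaysIn (x + dx s) (y + dy s) w → StaysIn x y (s ∷ w)

InS : Walk → Set
InS w = StaysIn 0ℤ 0ℤ w

data Dir : Set where
  up flat down : Dir

data Colour : Set where
  red black : Colour

record MStep : Set where
  constructor mstep
  field
    dir    : Dir
    colour : Colour
    marked : Bool

MPath : Set
MPath = List MStep

height : Dir → ℤ
height up = 1ℤ
height flat = 0ℤ
height down = -1ℤ

data MotzkinFrom : ℤ → MPath → Set where
  done : MotzkinFrom 0ℤ []
  step : ∀ {h m} → 0ℤ ≤ h + height (MStep.dir m) → ∀ {ms} →
         MotzkinFrom (h + height (MStep.dir m)) ms → MotzkinFrom h (m ∷ ms)

InMM2 : MPath → Set
InMM2 m = MotzkinFrom 0ℤ m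

-- Operates on the REVERSED path, so "leftmost" here is
-- "rightmost" in the path.  If no such step exists the path is unchanged
-- (this never happens for walks in 𝒮).

replA-rev : MPath → MPath
replA-rev [] = []
replA-rev (mstep flat red true ∷ ms)   = mstep up red false ∷ ms
replA-rev (mstep down black true ∷ ms) = mstep flat black false ∷ ms
replA-rev (m ∷ ms) = m ∷ replA-rev ms

replB-rev : MPath → MPath
replB-rev [] = []
replB-rev (mstep flat black true ∷ ms) = mstep up black false ∷ ms
replB-rev (mstep down red true ∷ ms)   = mstep flat red false ∷ ms
replB-rev (m ∷ ms) = m ∷ replB-rev ms

φ-step-rev : MPath → Step → MPath
φ-step-rev r N  = mstep flat red true ∷ r
φ-step-rev r E  = mstep flat black true ∷ r
φ-step-rev r SE = mstep down red true ∷ replA-rev r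
φ-step-rev r NW = mstep down black true ∷ replB-rev r
φ-step-rev r W  = mstep down red false ∷ replB-rev r
φ-step-rev r S  = mstep down black false ∷ replA-rev r

φ : Walk → MPath
φ w = reverse (foldl φ-step-rev [] w)

-- The number of marked steps that a later ↖ or ← (resp. ↘ or ↓) may still
-- replace equals the current x (resp. y) coordinate of the walk; hence a walk
-- in 𝒮, run after any prefix, only ever replaces steps it produced itself,
-- which gives (a).
-- For (b) cut w after |m₁| steps. Each replacement the second part makes inside
-- φ(w₁) raises the weight of that part (up = 2, flat = 1, down = 0) by one. Both
-- φ(w₁) and the Motzkin path m₁ have weight equal to their length, so no such
-- replacement occurs: the second part then behaves like a walk in 𝒮 from the
-- origin and produces m₂.

module Submission where

open import Defs
open import Data.Bool using (true; false)
open import Data.Integer as ℤ using (+≤+; 0ℤ)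
open import Data.List using ([]; _∷_; _++_; reverse; foldl; length; map; take; drop)
open import Data.List.Properties
  using ( map-++; ++-cancelʳ; ∷-injective; foldl-++; reverse-++; reverse-map
        ; length-reverse; length-++-≤ˡ; length-take; take++drop≡id)
open import Data.List.Relation.Binary.Permutation.Propositional.Properties using (↭-reverse)
open import Data.Nat using (ℕ; zero; suc; _+_; _<_; _≤_; z≤n)
open import Data.Nat.ListAction using (sum)
open import Data.Nat.ListAction.Properties using (sum-++; sum-↭)
open import Data.Nat.Properties
  using (1+n≢0; +-comm; +-identityʳ; +-suc; suc-injective; n<1+n; <-irrefl; <-trans; m≤n⇒m⊓n≡m)
open import Data.Product using (Σ; ∃; _×_; _,_; proj₁; proj₂; map₁; map₂)
open import Data.Empty using (⊥-elim)
open import Data.Sum as Sum using (_⊎_; inj₁; inj₂)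
open import Relation.Binary.PropositionalEquality
open ≡-Reasoning

Point : Set
Point = ℕ × ℕ

data _─[_]→_ : Point → Step → Point → Set where
  east      : ∀ {x y} → (x , y)     ─[ E  ]→ (suc x , y)
  southEast : ∀ {x y} → (x , suc y) ─[ SE ]→ (suc x , y)
  south     : ∀ {x y} → (x , suc y) ─[ S  ]→ (x , y)
  west      : ∀ {x y} → (suc x , y) ─[ W  ]→ (x , y)
  northWest : ∀ {x y} → (suc x , y) ─[ NW ]→ (x , suc y)
  north     : ∀ {x y} → (x , y)     ─[ N  ]→ (x , suc y)

data QuarterWalk : Point → Walk → Set where
  []  : ∀ {p} → QuarterWalk p []
  _∷_ : ∀ {p s p′ w} → p ─[ s ]→ p′ → QuarterWalk p′ w → QuarterWalk p (s ∷ w)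

QuarterWalk-++⁻ˡ : ∀ {p} w {v} → QuarterWalk p (w ++ v) → QuarterWalk p w
QuarterWalk-++⁻ˡ []      _         = []
QuarterWalk-++⁻ˡ (_ ∷ w) (mv ∷ wk) = mv ∷ QuarterWalk-++⁻ˡ w wk

move-coordinates : ∀ {x y s x′ y′} → (x , y) ─[ s ]→ (x′ , y′) →
                   ℤ.+ x ℤ.+ dx s ≡ ℤ.+ x′ × ℤ.+ y ℤ.+ dy s ≡ ℤ.+ y′
move-coordinates {x} {y} east      = cong ℤ.+_ (+-comm x 1) , cong ℤ.+_ (+-identityʳ y)
move-coordinates {x}     southEast = cong ℤ.+_ (+-comm x 1) , refl
move-coordinates {x}     south     = cong ℤ.+_ (+-identityʳ x) , refl
move-coordinates {y = y} west      = refl , cong ℤ.+_ (+-identityʳ y)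
move-coordinates {y = y} northWest = refl , cong ℤ.+_ (+-comm y 1)
move-coordinates {x} {y} north     = cong ℤ.+_ (+-identityʳ x) , cong ℤ.+_ (+-comm y 1)

move-exists : ∀ x y s → 0ℤ ℤ.≤ ℤ.+ x ℤ.+ dx s → 0ℤ ℤ.≤ ℤ.+ y ℤ.+ dy s →
              ∃ λ p → (x , y) ─[ s ]→ p
move-exists x y       E  _  _  = _ , east
move-exists x (suc y) SE _  _  = _ , southEast
move-exists x (suc y) S  _  _  = _ , south
move-exists (suc x) y W  _  _  = _ , west
move-exists (suc x) y NW _  _  = _ , northWest
move-exists x y       N  _  _  = _ , north
move-exists x zero    SE _  ()
move-exists x zero    S  _  ()
move-exists zero y    W  () _
move-exists zero y    NW () _

StaysIn-start : ∀ {a b w} → StaysIn a b w → 0ℤ ℤ.≤ a × 0ℤ ℤ.≤ b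
StaysIn-start (done 0≤a 0≤b)   = 0≤a , 0≤b
StaysIn-start (step 0≤a 0≤b _) = 0≤a , 0≤b

fromStaysIn : ∀ {x y w} → StaysIn (ℤ.+ x) (ℤ.+ y) w → QuarterWalk (x , y) w
fromStaysIn (done _ _) = []
fromStaysIn {x} {y} {s ∷ w} (step _ _ rest)
  with _ , mv ← move-exists x y s (proj₁ (StaysIn-start rest)) (proj₂ (StaysIn-start rest))
  = let (x≡ , y≡) = move-coordinates mv in
    mv ∷ fromStaysIn (subst₂ (λ a b → StaysIn a b w) x≡ y≡ rest)

toStaysIn : ∀ {x y w} → QuarterWalk (x , y) w → StaysIn (ℤ.+ x) (ℤ.+ y) w
toStaysIn []        = done (+≤+ z≤n) (+≤+ z≤n)
toStaysIn (mv ∷ wk) =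
  let (x≡ , y≡) = move-coordinates mv in
  step (+≤+ z≤n) (+≤+ z≤n) (subst₂ (λ a b → StaysIn a b _) (sym x≡) (sym y≡) (toStaysIn wk))

data Axis : Set where
  X Y : Axis

other : Axis → Axis
other X = Y
other Y = X

-- openOn X m = 1 iff a later ↖ or ← may pick m; openOn Y m = 1 iff a later ↘ or ↓ may.
openOn : Axis → MStep → ℕ
openOn X (mstep flat black true) = 1
openOn X (mstep down red   true) = 1
openOn X _                       = 0
openOn Y (mstep flat red   true) = 1
openOn Y (mstep down black true) = 1
openOn Y _                       = 0

replace : Axis → MPath → MPath
replace X = replB-rev
replace Y = replA-rev

stepWeight : MStep → ℕ
stepWeight (mstep up   _ _) = 2
stepWeight (mstep flat _ _) = 1
stepWeight (mstep down _ _) = 0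

pending : Axis → MPath → ℕ
pending a ms = sum (map (openOn a) ms)

weight : MPath → ℕ
weight ms = sum (map stepWeight ms)

data ReplaceView (a : Axis) (m : MStep) : Set where
  picked  : (m′ : MStep) → openOn a m ≡ 1 → openOn a m′ ≡ 0 →
            openOn (other a) m′ ≡ openOn (other a) m → stepWeight m′ ≡ suc (stepWeight m) →
            (∀ ms → replace a (m ∷ ms) ≡ m′ ∷ ms) → ReplaceView a m
  skipped : openOn a m ≡ 0 → (∀ ms → replace a (m ∷ ms) ≡ m ∷ replace a ms) →
            ReplaceView a m

replaceView : ∀ a m → ReplaceView a m
replaceView X (mstep up   c     b    ) = skipped refl (λ _ → refl)
replaceView X (mstep flat red   b    ) = skipped refl (λ _ → refl)
replaceView X (mstep flat black true ) = picked (mstep up black false) refl refl refl refl (λ _ → refl)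
replaceView X (mstep flat black false) = skipped refl (λ _ → refl)
replaceView X (mstep down red   true ) = picked (mstep flat red false) refl refl refl refl (λ _ → refl)
replaceView X (mstep down red   false) = skipped refl (λ _ → refl)
replaceView X (mstep down black b    ) = skipped refl (λ _ → refl)
replaceView Y (mstep up   c     b    ) = skipped refl (λ _ → refl)
replaceView Y (mstep flat red   true ) = picked (mstep up red false) refl refl refl refl (λ _ → refl)
replaceView Y (mstep flat red   false) = skipped refl (λ _ → refl)
replaceView Y (mstep flat black b    ) = skipped refl (λ _ → refl)
replaceView Y (mstep down red   b    ) = skipped refl (λ _ → refl)
replaceView Y (mstep down black true ) = picked (mstep flat black false) refl refl refl refl (λ _ → refl)
replaceView Y (mstep down black false) = skipped refl (λ _ → refl)

pending-++ : ∀ a q r → pending a (q ++ r) ≡ pending a q + pending a r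
pending-++ a q r = trans (cong sum (map-++ (openOn a) q r)) (sum-++ (map (openOn a) q) _)

weight-reverse : ∀ ms → weight (reverse ms) ≡ weight ms
weight-reverse ms =
  trans (cong sum (reverse-map stepWeight ms)) (sum-↭ (↭-reverse (map stepWeight ms)))

length-replace : ∀ a q → length (replace a q) ≡ length q
length-replace X []      = refl
length-replace Y []      = refl
length-replace a (m ∷ q) with replaceView a m
... | picked _ _ _ _ _ eq = cong length (eq q)
... | skipped _ eq        = trans (cong length (eq q)) (cong suc (length-replace a q))

replace-skips : ∀ a q → pending a q ≡ 0 → ∀ r → replace a (q ++ r) ≡ q ++ replace a r
replace-skips a []      _ r = refl
replace-skips a (m ∷ q) e r with replaceView a m
... | picked _ m-open _ _ _ _ = ⊥-elim (1+n≢0 (subst (λ k → k + pending a q ≡ 0) m-open e))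
... | skipped m-closed eq     =
  trans (eq (q ++ r))
        (cong (m ∷_) (replace-skips a q (subst (λ k → k + pending a q ≡ 0) m-closed e) r))

record Pick (a : Axis) (q : MPath) (n : ℕ) : Set where
  field
    replace-++     : ∀ r → replace a (q ++ r) ≡ replace a q ++ r
    pending-picked : pending a (replace a q) ≡ n
    pending-other  : pending (other a) (replace a q) ≡ pending (other a) q
    weight-picked  : weight (replace a q) ≡ suc (weight q)

replace-picks : ∀ a q {n} → pending a q ≡ suc n → Pick a q n
replace-picks a (m ∷ q) {n} e with replaceView a m
... | picked m′ m-open m′-closed other-kept heavier eq = record
  { replace-++     = λ r → trans (eq (q ++ r)) (cong (_++ r) (sym (eq q)))
  ; pending-picked = trans (cong (pending a) (eq q))
      (cong₂ _+_ m′-closed (suc-injective (subst (λ k → k + pending a q ≡ suc n) m-open e)))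
  ; pending-other  = trans (cong (pending (other a)) (eq q)) (cong (_+ pending (other a) q) other-kept)
  ; weight-picked  = trans (cong weight (eq q)) (cong (_+ weight q) heavier)
  }
... | skipped m-closed eq = record
  { replace-++     = λ r →
      trans (eq (q ++ r)) (trans (cong (m ∷_) (replace-++ r)) (cong (_++ r) (sym (eq q))))
  ; pending-picked = trans (cong (pending a) (eq q)) (cong₂ _+_ m-closed pending-picked)
  ; pending-other  = trans (cong (pending (other a)) (eq q)) (cong (openOn (other a) m +_) pending-other)
  ; weight-picked  =
      trans (cong weight (eq q)) (trans (cong (stepWeight m +_) weight-picked) (+-suc _ _))
  }
  where open Pick (replace-picks a q (subst (λ k → k + pending a q ≡ suc n) m-closed e))

position : MPath → Point
position q = pending X q , pending Y q

φ-from : MPath → Walk → MPath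
φ-from = foldl φ-step-rev

length-φ-step-rev : ∀ q s → length (φ-step-rev q s) ≡ suc (length q)
length-φ-step-rev q E  = refl
length-φ-step-rev q SE = cong suc (length-replace Y q)
length-φ-step-rev q S  = cong suc (length-replace Y q)
length-φ-step-rev q W  = cong suc (length-replace X q)
length-φ-step-rev q NW = cong suc (length-replace X q)
length-φ-step-rev q N  = refl

length-φ-from : ∀ q w → length (φ-from q w) ≡ length q + length w
length-φ-from q []      = sym (+-identityʳ (length q))
length-φ-from q (s ∷ w) = begin
  length (φ-from (φ-step-rev q s) w)  ≡⟨ length-φ-from (φ-step-rev q s) w ⟩
  length (φ-step-rev q s) + length w  ≡⟨ cong (_+ length w) (length-φ-step-rev q s) ⟩
  suc (length q) + length w           ≡⟨ +-suc (length q) (length w) ⟨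
  length q + length (s ∷ w)           ∎

record LegalStep (q : MPath) (s : Step) (p : Point) : Set where
  field
    φ-step-++     : ∀ r → φ-step-rev (q ++ r) s ≡ φ-step-rev q s ++ r
    position-step : position (φ-step-rev q s) ≡ p
    weight-step   : weight (φ-step-rev q s) ≡ suc (weight q)

legal-step : ∀ {q s p} → position q ─[ s ]→ p → LegalStep q s p
legal-step {q} = legal refl
  where
  legal : ∀ {p₀ s p} → position q ≡ p₀ → p₀ ─[ s ]→ p → LegalStep q s p
  legal e east      = record
    { φ-step-++ = λ _ → refl ; position-step = cong (map₁ suc) e ; weight-step = refl }
  legal e north     = record
    { φ-step-++ = λ _ → refl ; position-step = cong (map₂ suc) e ; weight-step = refl }
  legal e southEast = record
    { φ-step-++     = λ r → cong (mstep down red true ∷_) (replace-++ r)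
    ; position-step = cong₂ _,_ (cong suc (trans pending-other (cong proj₁ e))) pending-picked
    ; weight-step   = weight-picked }
    where open Pick (replace-picks Y q (cong proj₂ e))
  legal e south     = record
    { φ-step-++     = λ r → cong (mstep down black false ∷_) (replace-++ r)
    ; position-step = cong₂ _,_ (trans pending-other (cong proj₁ e)) pending-picked
    ; weight-step   = weight-picked }
    where open Pick (replace-picks Y q (cong proj₂ e))
  legal e west      = record
    { φ-step-++     = λ r → cong (mstep down red false ∷_) (replace-++ r)
    ; position-step = cong₂ _,_ pending-picked (trans pending-other (cong proj₂ e))
    ; weight-step   = weight-picked }
    where open Pick (replace-picks X q (cong proj₁ e))
  legal e northWest = record
    { φ-step-++     = λ r → cong (mstep down black true ∷_) (replace-++ r)
    ; position-step = cong₂ _,_ pending-picked (cong suc (trans pending-other (cong proj₂ e)))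
    ; weight-step   = weight-picked }
    where open Pick (replace-picks X q (cong proj₁ e))

QuarterWalk-step : ∀ {q s w} → QuarterWalk (position q) (s ∷ w) →
                   QuarterWalk (position (φ-step-rev q s)) w
QuarterWalk-step (mv ∷ wk) =
  subst (λ p → QuarterWalk p _) (sym (LegalStep.position-step (legal-step mv))) wk

QuarterWalk-++⁻ʳ : ∀ q w {v} → QuarterWalk (position q) (w ++ v) →
                   QuarterWalk (position (φ-from q w)) v
QuarterWalk-++⁻ʳ q []      wk = wk
QuarterWalk-++⁻ʳ q (s ∷ w) wk = QuarterWalk-++⁻ʳ (φ-step-rev q s) w (QuarterWalk-step wk)

φ-from-++ : ∀ q {w} → QuarterWalk (position q) w →
            ∀ r → φ-from (q ++ r) w ≡ φ-from q w ++ r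
φ-from-++ q {[]}    _              r = refl
φ-from-++ q {s ∷ w} wk@(mv ∷ _) r = begin
  φ-from (φ-step-rev (q ++ r) s) w
    ≡⟨ cong (λ t → φ-from t w) (LegalStep.φ-step-++ (legal-step mv) r) ⟩
  φ-from (φ-step-rev q s ++ r) w    ≡⟨ φ-from-++ (φ-step-rev q s) (QuarterWalk-step wk) r ⟩
  φ-from (φ-step-rev q s) w ++ r    ∎

weight-φ-from : ∀ q {w} → QuarterWalk (position q) w →
                weight (φ-from q w) ≡ weight q + length w
weight-φ-from q {[]}    _              = sym (+-identityʳ (weight q))
weight-φ-from q {s ∷ w} wk@(mv ∷ _) = begin
  weight (φ-from (φ-step-rev q s) w)  ≡⟨ weight-φ-from (φ-step-rev q s) (QuarterWalk-step wk) ⟩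
  weight (φ-step-rev q s) + length w
    ≡⟨ cong (_+ length w) (LegalStep.weight-step (legal-step mv)) ⟩
  suc (weight q) + length w           ≡⟨ +-suc (weight q) (length w) ⟨
  weight q + length (s ∷ w)           ∎

replace-on-++ : ∀ a q r {n} → pending a (q ++ r) ≡ suc n →
                (∃ λ k → pending a q ≡ suc k)
                ⊎ (replace a (q ++ r) ≡ q ++ replace a r × weight (replace a r) ≡ suc (weight r))
replace-on-++ a q r {n} e with pending a q in q-pending
... | suc k = inj₁ (k , refl)
... | zero  = inj₂ (replace-skips a q q-pending r , Pick.weight-picked (replace-picks a r r-pending))
  where
  r-pending : pending a r ≡ suc n
  r-pending = trans (cong (_+ pending a r) (sym q-pending)) (trans (sym (pending-++ a q r)) e)

data StepOn++ (q r : MPath) (s : Step) : Set where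
  within-left : ∀ {p} → position q ─[ s ]→ p → StepOn++ q r s
  into-right  : ∀ q′ r′ → φ-step-rev (q ++ r) s ≡ q′ ++ r′ →
                length r′ ≡ length r → weight r′ ≡ suc (weight r) → StepOn++ q r s

step-on-++ : ∀ {q r s p} → position (q ++ r) ─[ s ]→ p → StepOn++ q r s
step-on-++ {q} {r} = on refl
  where
  on : ∀ {p₀ s p} → position (q ++ r) ≡ p₀ → p₀ ─[ s ]→ p → StepOn++ q r s
  on _ east  = within-left east
  on _ north = within-left north
  on e southEast with replace-on-++ Y q r (cong proj₂ e)
  ... | inj₁ (k , eq) =
    within-left
      (subst (λ n → (pending X q , n) ─[ SE ]→ (suc (pending X q) , k)) (sym eq) southEast)
  ... | inj₂ (skip , heavier) =
    into-right (mstep down red true ∷ q) (replace Y r)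
      (cong (mstep down red true ∷_) skip) (length-replace Y r) heavier
  on e south with replace-on-++ Y q r (cong proj₂ e)
  ... | inj₁ (k , eq) =
    within-left (subst (λ n → (pending X q , n) ─[ S ]→ (pending X q , k)) (sym eq) south)
  ... | inj₂ (skip , heavier) =
    into-right (mstep down black false ∷ q) (replace Y r)
      (cong (mstep down black false ∷_) skip) (length-replace Y r) heavier
  on e west with replace-on-++ X q r (cong proj₁ e)
  ... | inj₁ (k , eq) =
    within-left (subst (λ n → (n , pending Y q) ─[ W ]→ (k , pending Y q)) (sym eq) west)
  ... | inj₂ (skip , heavier) =
    into-right (mstep down red false ∷ q) (replace X r)
      (cong (mstep down red false ∷_) skip) (length-replace X r) heavier
  on e northWest with replace-on-++ X q r (cong proj₁ e)
  ... | inj₁ (k , eq) =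
    within-left
      (subst (λ n → (n , pending Y q) ─[ NW ]→ (k , suc (pending Y q))) (sym eq) northWest)
  ... | inj₂ (skip , heavier) =
    into-right (mstep down black true ∷ q) (replace X r)
      (cong (mstep down black true ∷_) skip) (length-replace X r) heavier

record Split (q r : MPath) (w : Walk) : Set where
  field
    front back   : MPath
    φ-from-split : φ-from (q ++ r) w ≡ front ++ back
    length-back  : length back ≡ length r
    kept-or-heavier : back ≡ r × QuarterWalk (position q) w ⊎ weight r < weight back

split-φ-from : ∀ w q r → QuarterWalk (position (q ++ r)) w → Split q r w
split-φ-from []      q r _ = record
  { front = q ; back = r ; φ-from-split = refl ; length-back = refl
  ; kept-or-heavier = inj₁ (refl , []) }
split-φ-from (s ∷ w) q r wk@(mv ∷ _) with step-on-++ {q} {r} mv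
... | within-left mv′ = record
  { front        = front
  ; back         = back
  ; φ-from-split = trans (cong (λ t → φ-from t w) (φ-step-++ r)) φ-from-split
  ; length-back  = length-back
  ; kept-or-heavier =
      Sum.map₁ (map₂ λ wk′ → mv′ ∷ subst (λ p → QuarterWalk p w) position-step wk′) kept-or-heavier
  }
  where
  open LegalStep (legal-step {q} mv′)
  open Split (split-φ-from w (φ-step-rev q s) r
               (subst (λ t → QuarterWalk (position t) w) (φ-step-++ r) (QuarterWalk-step wk)))
... | into-right q′ r′ eq same-length heavier = record
  { front        = front
  ; back         = back
  ; φ-from-split = trans (cong (λ t → φ-from t w) eq) φ-from-split
  ; length-back  = trans length-back same-length
  ; kept-or-heavier = inj₂ (grown kept-or-heavier)
  }
  where
  open Split (split-φ-from w q′ r′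
               (subst (λ t → QuarterWalk (position t) w) eq (QuarterWalk-step wk)))
  r<r′ : weight r < weight r′
  r<r′ = subst (weight r <_) (sym heavier) (n<1+n (weight r))
  grown : back ≡ r′ × QuarterWalk (position q′) w ⊎ weight r′ < weight back →
          weight r < weight back
  grown (inj₁ (back≡r′ , _)) = subst (λ t → weight r < weight t) (sym back≡r′) r<r′
  grown (inj₂ r′<back)       = <-trans r<r′ r′<back

weight-MotzkinFrom : ∀ n {m} → MotzkinFrom (ℤ.+ n) m → weight m + n ≡ length m
weight-MotzkinFrom n       {[]}                  done          = refl
weight-MotzkinFrom n       {mstep up   _ _ ∷ ms} (step _ rest) =
  cong suc (trans (sym (+-suc (weight ms) n))
                  (trans (cong (weight ms +_) (+-comm 1 n)) (weight-MotzkinFrom (n + 1) rest)))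
weight-MotzkinFrom n       {mstep flat _ _ ∷ ms} (step _ rest) =
  cong suc (trans (cong (weight ms +_) (sym (+-identityʳ n))) (weight-MotzkinFrom (n + 0) rest))
weight-MotzkinFrom zero    {mstep down _ _ ∷ _}  (step () _)
weight-MotzkinFrom (suc n) {mstep down _ _ ∷ ms} (step _ rest) =
  trans (+-suc (weight ms) n) (cong suc (weight-MotzkinFrom n rest))

weight≡length : ∀ {m} → InMM2 m → weight m ≡ length m
weight≡length {m} mm = trans (sym (+-identityʳ (weight m))) (weight-MotzkinFrom 0 mm)

++-injective-length : ∀ (xs ys : MPath) {zs ws} → length xs ≡ length ys →
                      xs ++ zs ≡ ys ++ ws → xs ≡ ys × zs ≡ ws
++-injective-length []       []       _ e = refl , e
++-injective-length (x ∷ xs) (y ∷ ys) l e =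
  let x≡y , e′ = ∷-injective e in
  map₁ (cong₂ _∷_ x≡y) (++-injective-length xs ys (suc-injective l) e′)

φ-++ : ∀ w₁ {w₂} → InS w₂ → φ (w₁ ++ w₂) ≡ φ w₁ ++ φ w₂
φ-++ w₁ {w₂} i₂ = begin
  reverse (φ-from [] (w₁ ++ w₂))
    ≡⟨ cong reverse (foldl-++ φ-step-rev [] w₁ w₂) ⟩
  reverse (φ-from (φ-from [] w₁) w₂)
    ≡⟨ cong reverse (φ-from-++ [] (fromStaysIn i₂) (φ-from [] w₁)) ⟩
  reverse (φ-from [] w₂ ++ φ-from [] w₁)
    ≡⟨ reverse-++ (φ-from [] w₂) (φ-from [] w₁) ⟩
  φ w₁ ++ φ w₂
    ∎

φ-++⁻-length : ∀ w₁ w₂ m₁ m₂ → QuarterWalk (0 , 0) (w₁ ++ w₂) → InMM2 m₁ →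
               length m₁ ≡ length w₁ → φ (w₁ ++ w₂) ≡ m₁ ++ m₂ →
               m₁ ≡ φ w₁ × m₂ ≡ φ w₂ × QuarterWalk (0 , 0) w₂
φ-++⁻-length w₁ w₂ m₁ m₂ wk mm₁ len e =
  Sum.[ kept , (λ r₁<back → ⊥-elim (<-irrefl (sym weight-back) r₁<back)) ] kept-or-heavier
  where
  r₁ : MPath
  r₁ = φ-from [] w₁
  open Split (split-φ-from w₂ [] r₁ (QuarterWalk-++⁻ʳ [] w₁ wk))

  halves : reverse back ≡ m₁ × reverse front ≡ m₂
  halves = ++-injective-length (reverse back) m₁
    (trans (length-reverse back) (trans length-back (trans (length-φ-from [] w₁) (sym len))))
    (begin
      reverse back ++ reverse front  ≡⟨ reverse-++ front back ⟨
      reverse (front ++ back)        ≡⟨ cong reverse φ-from-split ⟨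
      reverse (φ-from r₁ w₂)         ≡⟨ cong reverse (foldl-++ φ-step-rev [] w₁ w₂) ⟨
      φ (w₁ ++ w₂)                   ≡⟨ e ⟩
      m₁ ++ m₂                       ∎)

  weight-back : weight back ≡ weight r₁
  weight-back = begin
    weight back            ≡⟨ weight-reverse back ⟨
    weight (reverse back)  ≡⟨ cong weight (proj₁ halves) ⟩
    weight m₁              ≡⟨ weight≡length mm₁ ⟩
    length m₁              ≡⟨ len ⟩
    length w₁              ≡⟨ weight-φ-from [] (QuarterWalk-++⁻ˡ w₁ wk) ⟨
    weight r₁              ∎

  kept : back ≡ r₁ × QuarterWalk (0 , 0) w₂ →
         m₁ ≡ φ w₁ × m₂ ≡ φ w₂ × QuarterWalk (0 , 0) w₂
  kept (back≡r₁ , wk₂) =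
    trans (sym (proj₁ halves)) (cong reverse back≡r₁) ,
    trans (sym (proj₂ halves)) (cong reverse front≡) ,
    wk₂
    where
    front≡ : front ≡ φ-from [] w₂
    front≡ = ++-cancelʳ r₁ front (φ-from [] w₂) (begin
      front ++ r₁            ≡⟨ cong (front ++_) back≡r₁ ⟨
      front ++ back          ≡⟨ φ-from-split ⟨
      φ-from r₁ w₂           ≡⟨ φ-from-++ [] wk₂ r₁ ⟩
      φ-from [] w₂ ++ r₁     ∎)

φ-++⁻ : ∀ w m₁ m₂ → InS w → InMM2 m₁ → φ w ≡ m₁ ++ m₂ →
        Σ Walk λ w₁ → Σ Walk λ w₂ →
          InS w₁ × InS w₂ × m₁ ≡ φ w₁ × m₂ ≡ φ w₂ × w ≡ w₁ ++ w₂
φ-++⁻ w m₁ m₂ iw mm₁ e =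
  let m₁≡ , m₂≡ , wk₂ = φ-++⁻-length w₁ w₂ m₁ m₂ wk mm₁ len (trans (cong φ w₁++w₂≡w) e) in
  w₁ , w₂ , toStaysIn (QuarterWalk-++⁻ˡ w₁ wk) , toStaysIn wk₂ , m₁≡ , m₂≡ , sym w₁++w₂≡w
  where
  k : ℕ
  k = length m₁
  w₁ w₂ : Walk
  w₁ = take k w
  w₂ = drop k w
  w₁++w₂≡w : w₁ ++ w₂ ≡ w
  w₁++w₂≡w = take++drop≡id k w
  wk : QuarterWalk (0 , 0) (w₁ ++ w₂)
  wk = subst (QuarterWalk (0 , 0)) (sym w₁++w₂≡w) (fromStaysIn iw)
  k≤length : k ≤ length w
  k≤length = subst (k ≤_)
    (trans (cong length (sym e)) (trans (length-reverse (φ-from [] w)) (length-φ-from [] w)))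
    (length-++-≤ˡ m₁)
  len : k ≡ length w₁
  len = sym (trans (length-take k w) (m≤n⇒m⊓n≡m k≤length))

mainTheorem5 :
    ((w₁ w₂ : Walk) → InS w₁ → InS w₂ → InS (w₁ ++ w₂) →
      φ (w₁ ++ w₂) ≡ φ w₁ ++ φ w₂)
    ×
    ((w : Walk) (m₁ m₂ : MPath) → InS w → InMM2 m₁ → InMM2 m₂ →
      φ w ≡ m₁ ++ m₂ →
      Σ Walk (λ w₁ → Σ Walk (λ w₂ →
        InS w₁ × InS w₂ × m₁ ≡ φ w₁ × m₂ ≡ φ w₂ × w ≡ w₁ ++ w₂)))
mainTheorem5 =
  (λ w₁ w₂ _ i₂ _ → φ-++ w₁ i₂) ,
  (λ w m₁ m₂ iw mm₁ _ → φ-++⁻ w m₁ m₂ iw mm₁)
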